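{- For every set $S$ of permutation patterns with $231\in S$, the set of alternating sign matrices that key-avoid every pattern of $S$ is exactly the set of permutation matrices of permutations avoiding every pattern of $S$; that is, $\mathrm{Av}^{\mathrm{key}}(S)=\mathrm{pAv}(S)$.
   Context: An alternating sign matrix (ASM) of size $n$ is an $n\times n$ matrix with entries in $\{0,1,-1\}$ such that every row and every column sums to $1$ and the nonzero entries of each row and of each column alternate in sign. Position $(i,j)$ is the $i$-th row from the top and $j$-th column from the left. The permutation matrix of $\sigma=\sigma(1)\dots\sigma(n)$ has a $1$ in row $i$, column $\sigma(i)$ for each $i$; permutations are identified with their permutation matrices (which are exactly the ASMs without $-1$ entries). A permutation $\sigma$ contains $\pi=\pi(1)\dots\pi(k)$ if there are indices $i_1<\dots<i_k$ with $\sigma(i_a)<\sigma(i_b)$ iff $\pi(a)<\pi(b)$; otherwise $\sigma$ avoids $\pi$. $\mathrm{pAv}(S)$ is the set of permutations avoiding all patterns in $S$. SW key process: a $-1$ entry is removable if no other $-1$ entry lies weakly southwest of it (weakly below and weakly to the left). For a removable $-1$ at $(i,j)$, let $(i,j_0)$ be the nearest $1$ to its west in its row and $(i_0,j)$ the nearest $1$ below it in its column; its neighboring $1$s are the $1$ entries weakly southwest of it such that no other $1$ entry lies both weakly northeast of them and weakly southwest of the $-1$. Consider the $1$s at $(i,j_0)$, $(i_0,j)$ and the neighboring $1$s lying in the rectangle of rows $i..i_0$ and columns $j_0..j$. Replace the south-most of these $1$s by $0$; then moving east to west, for each subsequent one of these $1$s, in column $c$ say, place a new $1$ in the row of the previously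 replaced $1$ and column $c$, and replace the old $1$ in column $c$ by $0$; finally replace the $-1$ by $0$. Repeating until no $-1$ remains yields a permutation matrix, independent of the order of removals, called the SW key of $A$. $\mathrm{Av}^{\mathrm{key}}(S)$ is the set of ASMs whose SW key avoids every pattern of $S$. -}

module Defs where

open import Data.Nat using (ℕ; zero; suc)
open import Data.Fin using (Fin; zero; suc; _<_; _≤_; _≟_)
open import Data.Vec using (Vec; []; _∷_; lookup)
open import Data.Integer using (ℤ; _+_; 0ℤ; 1ℤ; -1ℤ)
open import Data.Product using (Σ; Σ-syntax; _×_; _,_)
open import Data.Sum using (_⊎_)
open import Data.Bool using (if_then_else_)
open import Relation.Nullary using (¬_)
open import Relation.Nullary.Decidable using (⌊_⌋)
open import Relation.Binary.PropositionalEquality using (_≡_; _≢_)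
open import Function.Definitions using (Injective)
open import Function.Bundles using (_⇔_)

-- Matrices: rows/columns indexed by Fin n; row 0 is the top row,
-- column 0 the leftmost column.  "South" = larger row index,
-- "west" = smaller column index.

Matrix : ℕ → Set
Matrix n = Fin n → Fin n → ℤ

sumFin : ∀ {n} → (Fin n → ℤ) → ℤ
sumFin {zero}  f = 0ℤ
sumFin {suc n} f = f zero + sumFin (λ k → f (suc k))

record IsASM {n : ℕ} (A : Matrix n) : Set where
  field
    entries  : ∀ i j → (A i j ≡ 0ℤ) ⊎ (A i j ≡ 1ℤ) ⊎ (A i j ≡ -1ℤ)
    rowSum   : ∀ i → sumFin (λ j → A i j) ≡ 1ℤ
    colSum   : ∀ j → sumFin (λ i → A i j) ≡ 1ℤ
    rowAlt   : ∀ i j j′ → j < j′ → A i j ≢ 0ℤ → A i j′ ≢ 0ℤ →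
               (∀ k → j < k → k < j′ → A i k ≡ 0ℤ) → A i j + A i j′ ≡ 0ℤ
    colAlt   : ∀ j i i′ → i < i′ → A i j ≢ 0ℤ → A i′ j ≢ 0ℤ →
               (∀ k → i < k → k < i′ → A k j ≡ 0ℤ) → A i j + A i′ j ≡ 0ℤ

-- a permutation of size n is an injective map Fin n → Fin n;
-- σ i is the column of the 1 in row i
IsPerm : ∀ {n} → (Fin n → Fin n) → Set
IsPerm σ = Injective _≡_ _≡_ σ

permMatrix : ∀ {n} → (Fin n → Fin n) → Matrix n
permMatrix σ i j = if ⌊ σ i ≟ j ⌋ then 1ℤ else 0ℤ

-- patterns are given in one-line notation as vectors
-- (0-based values: 231 is [1,2,0])
Pattern : ℕ → Set
Pattern k = Vec (Fin k) k

IsPermPattern : ∀ {k} → Pattern k → Set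
IsPermPattern π = Injective _≡_ _≡_ (lookup π)

p231 : Pattern 3
p231 = suc zero ∷ suc (suc zero) ∷ zero ∷ []

StrictlyIncreasing : ∀ {k n} → (Fin k → Fin n) → Set
StrictlyIncreasing ι = ∀ a b → a < b → ι a < ι b

Contains : ∀ {n k} → (Fin n → Fin n) → Pattern k → Set
Contains {n} {k} σ π =
  Σ[ ι ∈ (Fin k → Fin n) ] StrictlyIncreasing ι ×
    (∀ a b → (σ (ι a) < σ (ι b)) ⇔ (lookup π a < lookup π b))

PatternSet : Set₁
PatternSet = (k : ℕ) → Pattern k → Set

Avoids : ∀ {n} → PatternSet → (Fin n → Fin n) → Set
Avoids S σ = ∀ k (π : Pattern k) → S k π → ¬ Contains σ π

module _ {n : ℕ} (A : Matrix n) where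

  Removable : Fin n → Fin n → Set
  Removable i j = A i j ≡ -1ℤ ×
    (∀ a b → i ≤ a → b ≤ j → ¬ (a ≡ i × b ≡ j) → A a b ≢ -1ℤ)

  WestOne : Fin n → Fin n → Fin n → Set
  WestOne i j j0 = j0 < j × A i j0 ≡ 1ℤ × (∀ k → j0 < k → k < j → A i k ≢ 1ℤ)

  SouthOne : Fin n → Fin n → Fin n → Set
  SouthOne i j i0 = i < i0 × A i0 j ≡ 1ℤ × (∀ k → i < k → k < i0 → A k j ≢ 1ℤ)

  Neighbor : Fin n → Fin n → Fin n → Fin n → Set
  Neighbor i j a b = A a b ≡ 1ℤ × i ≤ a × b ≤ j ×
    (∀ c d → A c d ≡ 1ℤ → c ≤ a → b ≤ d → i ≤ c → d ≤ j → (c ≡ a × d ≡ b))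

  -- the 1s taking part in the removal of the -1 at (i,j)
  InT : (i j i0 j0 : Fin n) → Fin n → Fin n → Set
  InT i j i0 j0 a b =
    ((a ≡ i × b ≡ j0) ⊎ (a ≡ i0 × b ≡ j) ⊎
     (Neighbor i j a b × i ≤ a × a ≤ i0 × j0 ≤ b × b ≤ j))

  record Removal (B : Matrix n) : Set where
    field
      i j i0 j0 : Fin n
      removable : Removable i j
      west      : WestOne i j j0
      south     : SouthOne i j i0
      sr sc     : Fin n
      southMost : InT i j i0 j0 sr sc × (∀ a b → InT i j i0 j0 a b → a ≤ sr)

    T : Fin n → Fin n → Set
    T = InT i j i0 j0

    Rest : Fin n → Fin n → Set
    Rest a b = T a b × ¬ (a ≡ sr × b ≡ sc)

    -- (a′,b′) is the 1 processed just before (a,b): processing starts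
    -- with the south-most one and then goes through Rest east to west
    Prev : Fin n → Fin n → Fin n → Fin n → Set
    Prev a′ b′ a b = Rest a b ×
      ((a′ ≡ sr × b′ ≡ sc × (∀ u v → Rest u v → v ≤ b))
       ⊎ (Rest a′ b′ × b < b′ × (∀ u v → Rest u v → b < v → b′ ≤ v)))

    Placed : Fin n → Fin n → Set
    Placed x y = Σ[ a ∈ Fin n ] Σ[ b′ ∈ Fin n ] Prev x b′ a y

    field
      atMinus : B i j ≡ 0ℤ
      placed  : ∀ x y → ¬ (x ≡ i × y ≡ j) → Placed x y → B x y ≡ 1ℤ
      zeroed  : ∀ x y → ¬ (x ≡ i × y ≡ j) → ¬ Placed x y → T x y → B x y ≡ 0ℤ
      kept    : ∀ x y → ¬ (x ≡ i × y ≡ j) → ¬ Placed x y → ¬ T x y →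
                B x y ≡ A x y

data Reaches {n : ℕ} : Matrix n → Matrix n → Set where
  done : ∀ {A P} → (∀ x y → A x y ≡ P x y) → Reaches A P
  step : ∀ {A B P} → Removal A B → Reaches B P → Reaches A P

IsSWKey : ∀ {n} → Matrix n → Matrix n → Set
IsSWKey A P = Reaches A P × (∀ x y → P x y ≢ -1ℤ)

AvKey : ∀ {n} → PatternSet → Matrix n → Set
AvKey S A = IsASM A ×
  Σ[ σ ∈ (Fin _ → Fin _) ] IsPerm σ × IsSWKey A (permMatrix σ) × Avoids S σ

InPAv : ∀ {n} → PatternSet → Matrix n → Set
InPAv S A = Σ[ σ ∈ (Fin _ → Fin _) ] IsPerm σ × Avoids S σ ×
  (∀ x y → A x y ≡ permMatrix σ x y)

{-# OPTIONS --safe #-}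
module Submission where

-- Every -1 of an ASM has a 1 above it in its column and a 1 to its right in
-- its row.  Removals preserve this: they only change entries weakly southwest
-- of the removed -1, and a 1 there flanking another -1 from above or from the
-- right would put that -1 weakly southwest of the removed one as well, against
-- removability.  Now consider the last removal of a key process, at (i, j): the
-- 1s at (i₁, j) with i₁ < i and at (i, j₁) with j < j₁ survive into the key,
-- and the first new 1 goes into the row of the south-most participating 1,
-- below row i, and into a column west of j.  Rows i₁ < i < that row carry the
-- values j, j₁ and something less than j: a 231.  So an ASM whose key avoids
-- 231 has no -1 at all and is its own key.

import Data.Integer.Properties as ℤP
open import Algebra.Properties.AbelianGroup ℤP.+-0-abelianGroup
  using (inverseˡ-unique; inverseʳ-unique)
open import Data.Empty using (⊥; ⊥-elim)
open import Data.Fin using (Fin; zero; suc; _<_; _≤_; _>_; _≟_; punchOut)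
open import Data.Fin.Induction using (>-wellFounded)
open import Data.Fin.Properties
  using (<-cmp; <-irrefl; <-asym; <-trans; <⇒≢; ≤-antisym; ≤∧≢⇒<; any?; pigeonhole;
         punchOut-injective; suc-injective)
open import Data.Integer using (ℤ; 0ℤ; 1ℤ; -1ℤ; _+_)
open import Data.Integer.Properties using (+-identityˡ; +-identityʳ)
open import Data.Nat using (ℕ; z<s; s<s; s<s⁻¹)
open import Data.Nat.Properties using (n<1+n; <⇒≤; <⇒≱; ≤-refl; ≤-trans; ≮⇒≥)
open import Data.Product using (Σ-syntax; _×_; _,_; proj₁; proj₂)
open import Data.Sum using (_⊎_; inj₁; inj₂)
open import Data.Vec using ([]; _∷_; lookup)
open import Defs
open import Function.Base using (_∘_)
open import Function.Bundles using (_⇔_; mk⇔)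
open import Induction.WellFounded using (Acc; acc)
open import Relation.Binary.Definitions using (tri<; tri≈; tri>)
open import Relation.Binary.PropositionalEquality
open import Relation.Nullary using (¬_; yes; no; contradiction)
open import Relation.Nullary.Decidable using (decidable-stable; ¬¬-excluded-middle)

sumFin-zero : ∀ {n} (f : Fin n → ℤ) → (∀ x → f x ≡ 0ℤ) → sumFin f ≡ 0ℤ
sumFin-zero {ℕ.zero} f f≡0 = refl
sumFin-zero {ℕ.suc n} f f≡0 =
  cong₂ _+_ (f≡0 zero) (sumFin-zero (f ∘ suc) (f≡0 ∘ suc))

sumFin-indicator : ∀ {n} (f : Fin n → ℤ) k → f k ≡ 1ℤ →
  (∀ x → x ≢ k → f x ≡ 0ℤ) → sumFin f ≡ 1ℤ
sumFin-indicator f zero fk≡1 f≡0 =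
  cong₂ _+_ fk≡1 (sumFin-zero (f ∘ suc) (λ x → f≡0 (suc x) λ ()))
sumFin-indicator f (suc k) fk≡1 f≡0 =
  cong₂ _+_ (f≡0 zero λ ())
    (sumFin-indicator (f ∘ suc) k fk≡1 (λ x x≢k → f≡0 (suc x) (x≢k ∘ suc-injective)))

Alternating : ∀ {n} → (Fin n → ℤ) → Set
Alternating {n} g = ∀ (a b : Fin n) → a < b → g a ≢ 0ℤ → g b ≢ 0ℤ →
  (∀ k → a < k → k < b → g k ≡ 0ℤ) → g a + g b ≡ 0ℤ

Alternating-tail : ∀ {n} {g : Fin (ℕ.suc n) → ℤ} → Alternating g → Alternating (g ∘ suc)
Alternating-tail alt a b a<b ga≢0 gb≢0 between =
  alt (suc a) (suc b) (s<s a<b) ga≢0 gb≢0 λ where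
    zero () _
    (suc k) a<k k<b → between k (s<s⁻¹ a<k) (s<s⁻¹ k<b)

module _ {n} (g : Fin n → ℤ) where

  FirstNonzero : Fin n → Set
  FirstNonzero k = g k ≢ 0ℤ × (∀ x → x < k → g x ≡ 0ℤ)

  LastNonzero : Fin n → Set
  LastNonzero l = g l ≢ 0ℤ × (∀ x → l < x → g x ≡ 0ℤ)

  data AlternatingView : Set where
    zeros : (∀ x → g x ≡ 0ℤ) → AlternatingView
    odd   : ∀ {k l} → FirstNonzero k → LastNonzero l →
            g l ≡ g k → sumFin g ≡ g k → AlternatingView
    even  : ∀ {k l} → FirstNonzero k → LastNonzero l →
            g k + g l ≡ 0ℤ → sumFin g ≡ 0ℤ → AlternatingView

module _ {n} {g : Fin (ℕ.suc n) → ℤ} where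

  FirstNonzero-head : g zero ≢ 0ℤ → FirstNonzero g zero
  FirstNonzero-head g₀≢0 = g₀≢0 , λ _ ()

  FirstNonzero-suc : ∀ {k} → g zero ≡ 0ℤ → FirstNonzero (g ∘ suc) k → FirstNonzero g (suc k)
  FirstNonzero-suc g₀≡0 (gk≢0 , before) = gk≢0 , λ where
    zero _ → g₀≡0
    (suc x) x<k → before x (s<s⁻¹ x<k)

  LastNonzero-head : g zero ≢ 0ℤ → (∀ x → g (suc x) ≡ 0ℤ) → LastNonzero g zero
  LastNonzero-head g₀≢0 tail≡0 = g₀≢0 , λ where
    zero ()
    (suc x) _ → tail≡0 x

  LastNonzero-suc : ∀ {l} → LastNonzero (g ∘ suc) l → LastNonzero g (suc l)
  LastNonzero-suc (gl≢0 , after) = gl≢0 , λ where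
    zero ()
    (suc x) l<x → after x (s<s⁻¹ l<x)

  head-cancels-first : Alternating g → g zero ≢ 0ℤ → ∀ {k} → FirstNonzero (g ∘ suc) k →
    g zero + g (suc k) ≡ 0ℤ
  head-cancels-first alt g₀≢0 (gk≢0 , before) =
    alt zero (suc _) z<s g₀≢0 gk≢0 λ where
      zero ()
      (suc x) _ x<k → before x (s<s⁻¹ x<k)

alternatingView : ∀ {n} (g : Fin n → ℤ) → Alternating g → AlternatingView g
alternatingView {ℕ.zero} g alt = zeros λ ()
alternatingView {ℕ.suc n} g alt
  with alternatingView (g ∘ suc) (Alternating-tail alt) | g zero ℤP.≟ 0ℤ
... | zeros tail≡0 | yes g₀≡0 = zeros λ where
  zero → g₀≡0
  (suc x) → tail≡0 x
... | zeros tail≡0 | no g₀≢0 =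
  odd (FirstNonzero-head g₀≢0) (LastNonzero-head g₀≢0 tail≡0) refl
      (trans (cong (g zero +_) (sumFin-zero (g ∘ suc) tail≡0)) (+-identityʳ _))
... | odd first last gl≡gk sum≡gk | yes g₀≡0 =
  odd (FirstNonzero-suc g₀≡0 first) (LastNonzero-suc last) gl≡gk
      (trans (cong₂ _+_ g₀≡0 sum≡gk) (+-identityˡ _))
... | even first last gk+gl≡0 sum≡0 | yes g₀≡0 =
  even (FirstNonzero-suc g₀≡0 first) (LastNonzero-suc last) gk+gl≡0
       (trans (cong₂ _+_ g₀≡0 sum≡0) (+-identityˡ _))
... | odd first last gl≡gk sum≡gk | no g₀≢0 =
  even (FirstNonzero-head g₀≢0) (LastNonzero-suc last)
       (trans (cong (g zero +_) gl≡gk) g₀+gk≡0) (trans (cong (g zero +_) sum≡gk) g₀+gk≡0)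
  where g₀+gk≡0 = head-cancels-first alt g₀≢0 first
... | even first last gk+gl≡0 sum≡0 | no g₀≢0 =
  odd (FirstNonzero-head g₀≢0) (LastNonzero-suc last)
      (trans (inverseʳ-unique _ _ gk+gl≡0) (sym (inverseˡ-unique _ _ g₀+gk≡0)))
      (trans (cong (g zero +_) sum≡0) (+-identityʳ _))
  where g₀+gk≡0 = head-cancels-first alt g₀≢0 first

module _ {n} (g : Fin n → ℤ) where

  OneBefore : Fin n → Set
  OneBefore y = Σ[ x ∈ Fin n ] x < y × g x ≡ 1ℤ

  OneAfter : Fin n → Set
  OneAfter y = Σ[ x ∈ Fin n ] y < x × g x ≡ 1ℤ

minusOne-between-ones : ∀ {n} (g : Fin n → ℤ) → Alternating g → sumFin g ≡ 1ℤ →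
  ∀ y → g y ≡ -1ℤ → OneBefore g y × OneAfter g y
minusOne-between-ones g alt sum≡1 y gy≡-1 with alternatingView g alt
... | zeros g≡0 = contradiction (trans (sym gy≡-1) (g≡0 y)) λ ()
... | even _ _ _ sum≡0 = contradiction (trans (sym sum≡0) sum≡1) λ ()
... | odd {k} {l} (_ , before-k) (_ , after-l) gl≡gk sum≡gk = before , after
  where
  gk≡1 : g k ≡ 1ℤ
  gk≡1 = trans (sym sum≡gk) sum≡1

  before : OneBefore g y
  before with <-cmp y k
  ... | tri< y<k _ _ = contradiction (trans (sym gy≡-1) (before-k y y<k)) λ ()
  ... | tri≈ _ refl _ = contradiction (trans (sym gy≡-1) gk≡1) λ ()
  ... | tri> _ _ k<y = k , k<y , gk≡1

  after : OneAfter g y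
  after with <-cmp y l
  ... | tri< y<l _ _ = l , y<l , trans gl≡gk gk≡1
  ... | tri≈ _ refl _ = contradiction (trans (sym gy≡-1) (trans gl≡gk gk≡1)) λ ()
  ... | tri> _ _ l<y = contradiction (trans (sym gy≡-1) (after-l y l<y)) λ ()

MinusOnesFlanked : ∀ {n} → Matrix n → Set
MinusOnesFlanked M = ∀ x y → M x y ≡ -1ℤ →
  OneBefore (λ x′ → M x′ y) x × OneAfter (λ y′ → M x y′) y

IsASM⇒MinusOnesFlanked : ∀ {n} {A : Matrix n} → IsASM A → MinusOnesFlanked A
IsASM⇒MinusOnesFlanked {A = A} asm x y Axy≡-1 =
  proj₁ (minusOne-between-ones (λ x′ → A x′ y) (colAlt y) (colSum y) x Axy≡-1) ,
  proj₂ (minusOne-between-ones (λ y′ → A x y′) (rowAlt x) (rowSum x) y Axy≡-1)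
  where open IsASM asm

StrictlyIncreasing-reflects-< : ∀ {k n} {τ : Fin k → Fin n} → StrictlyIncreasing τ →
  ∀ {a b} → τ a < τ b → a < b
StrictlyIncreasing-reflects-< {τ = τ} τ-inc {a} {b} τa<τb with <-cmp a b
... | tri< a<b _ _ = a<b
... | tri≈ _ refl _ = contradiction τa<τb (<-irrefl refl)
... | tri> _ _ b<a = contradiction τa<τb (<-asym (τ-inc b a b<a))

contains-via-relabelling : ∀ {n k} (σ : Fin n → Fin n) (π : Pattern k)
  {ι τ : Fin k → Fin n} → StrictlyIncreasing ι → StrictlyIncreasing τ →
  (∀ a → σ (ι a) ≡ τ (lookup π a)) → Contains σ π
contains-via-relabelling σ π {ι} {τ} ι-inc τ-inc σι≡τπ = ι , ι-inc , λ a b →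
  mk⇔ (λ σιa<σιb → StrictlyIncreasing-reflects-< τ-inc (subst₂ _<_ (σι≡τπ a) (σι≡τπ b) σιa<σιb))
      (λ πa<πb → subst₂ _<_ (sym (σι≡τπ a)) (sym (σι≡τπ b)) (τ-inc _ _ πa<πb))

increasing₃ : ∀ {n} {x y z : Fin n} → x < y → y < z → StrictlyIncreasing (lookup (x ∷ y ∷ z ∷ []))
increasing₃ x<y y<z zero (suc zero) _ = x<y
increasing₃ x<y y<z zero (suc (suc zero)) _ = <-trans x<y y<z
increasing₃ x<y y<z (suc zero) (suc (suc zero)) _ = y<z
increasing₃ _ _ zero zero ()
increasing₃ _ _ (suc zero) zero ()
increasing₃ _ _ (suc (suc zero)) zero ()
increasing₃ _ _ (suc zero) (suc zero) (s<s ())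
increasing₃ _ _ (suc (suc zero)) (suc zero) (s<s ())
increasing₃ _ _ (suc (suc zero)) (suc (suc zero)) (s<s (s<s ()))

contains-231 : ∀ {n} (σ : Fin n → Fin n) {r₁ r₂ r₃ : Fin n} → r₁ < r₂ → r₂ < r₃ →
  σ r₃ < σ r₁ → σ r₁ < σ r₂ → Contains σ p231
contains-231 σ r₁<r₂ r₂<r₃ σr₃<σr₁ σr₁<σr₂ =
  contains-via-relabelling σ p231 (increasing₃ r₁<r₂ r₂<r₃) (increasing₃ σr₃<σr₁ σr₁<σr₂) λ where
    zero → refl
    (suc zero) → refl
    (suc (suc zero)) → refl

module _ {n} (σ : Fin n → Fin n) where

  permMatrix-one : ∀ {x y} → σ x ≡ y → permMatrix σ x y ≡ 1ℤ
  permMatrix-one {x} {y} σx≡y with σ x ≟ y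
  ... | yes _ = refl
  ... | no σx≢y = contradiction σx≡y σx≢y

  permMatrix-zero : ∀ {x y} → σ x ≢ y → permMatrix σ x y ≡ 0ℤ
  permMatrix-zero {x} {y} σx≢y with σ x ≟ y
  ... | yes σx≡y = contradiction σx≡y σx≢y
  ... | no _ = refl

  permMatrix-nonzero : ∀ {x y} → permMatrix σ x y ≢ 0ℤ → σ x ≡ y
  permMatrix-nonzero {x} {y} nonzero with σ x ≟ y
  ... | yes σx≡y = σx≡y
  ... | no _ = contradiction refl nonzero

  permMatrix≢-1 : ∀ x y → permMatrix σ x y ≢ -1ℤ
  permMatrix≢-1 x y with σ x ≟ y
  ... | yes _ = λ ()
  ... | no _ = λ ()

injective⇒surjective : ∀ {n} {σ : Fin n → Fin n} → IsPerm σ → ∀ y → Σ[ x ∈ Fin n ] σ x ≡ y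
injective⇒surjective {ℕ.suc m} {σ} σ-inj y = decidable-stable (any? λ x → σ x ≟ y) ¬¬hit
  where
  -- A missed value would let σ inject Fin (1 + m) into Fin m.
  ¬¬hit : ¬ ¬ (Σ[ x ∈ Fin (ℕ.suc m) ] σ x ≡ y)
  ¬¬hit missed
    with pigeonhole (n<1+n m) (λ x → punchOut {i = y} {j = σ x} (missed ∘ (x ,_) ∘ sym))
  ... | a , b , a<b , same =
    <⇒≢ a<b (σ-inj (punchOut-injective (missed ∘ (a ,_) ∘ sym) (missed ∘ (b ,_) ∘ sym) same))

permutation-isASM : ∀ {n} {σ : Fin n → Fin n} {A : Matrix n} → IsPerm σ →
  (∀ x y → A x y ≡ permMatrix σ x y) → IsASM A
permutation-isASM {σ = σ} {A} σ-inj A≗σ = record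
  { entries = entries
  ; rowSum  = λ x → sumFin-indicator (A x) (σ x) (one refl) (λ y y≢σx → off (y≢σx ∘ sym))
  ; colSum  = λ y → let (x , σx≡y) = injective⇒surjective σ-inj y in
      sumFin-indicator (λ x′ → A x′ y) x (one σx≡y)
        (λ x′ x′≢x → off (λ σx′≡y → x′≢x (σ-inj (trans σx′≡y (sym σx≡y)))))
  ; rowAlt  = λ x y y′ y<y′ nz nz′ _ →
      contradiction (trans (sym (column nz)) (column nz′)) (<⇒≢ y<y′)
  ; colAlt  = λ y x x′ x<x′ nz nz′ _ →
      contradiction (σ-inj (trans (column nz) (sym (column nz′)))) (<⇒≢ x<x′)
  }
  where
  one : ∀ {x y} → σ x ≡ y → A x y ≡ 1ℤ
  one σx≡y = trans (A≗σ _ _) (permMatrix-one σ σx≡y)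

  off : ∀ {x y} → σ x ≢ y → A x y ≡ 0ℤ
  off σx≢y = trans (A≗σ _ _) (permMatrix-zero σ σx≢y)

  column : ∀ {x y} → A x y ≢ 0ℤ → σ x ≡ y
  column nonzero = permMatrix-nonzero σ (nonzero ∘ trans (A≗σ _ _))

  entries : ∀ x y → (A x y ≡ 0ℤ) ⊎ (A x y ≡ 1ℤ) ⊎ (A x y ≡ -1ℤ)
  entries x y with σ x ≟ y
  ... | yes σx≡y = inj₂ (inj₁ (one σx≡y))
  ... | no σx≢y = inj₁ (off σx≢y)

¬¬-greatest : ∀ {n} (P : Fin n → Set) {b} → P b →
  ¬ ¬ (Σ[ m ∈ Fin n ] P m × (∀ v → P v → v ≤ m))
¬¬-greatest {n} P = go (>-wellFounded _)
  where
  go : ∀ {b} → Acc _>_ b → P b → ¬ ¬ (Σ[ m ∈ Fin n ] P m × (∀ v → P v → v ≤ m))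
  go {b} (acc above) Pb ¬greatest =
    ¬greatest (b , Pb , λ v Pv → ≮⇒≥ λ b<v → go (above b<v) Pv ¬greatest)

module _ {n} {M B : Matrix n} (r : Removal M B) where
  open Removal r

  participant-bounds : ∀ {a b} → T a b → i ≤ a × a ≤ i0 × b ≤ j
  participant-bounds (inj₁ (refl , refl)) = ≤-refl , <⇒≤ (proj₁ south) , <⇒≤ (proj₁ west)
  participant-bounds (inj₂ (inj₁ (refl , refl))) = <⇒≤ (proj₁ south) , ≤-refl , ≤-refl
  participant-bounds (inj₂ (inj₂ ((_ , i≤a , b≤j , _) , _ , a≤i0 , _))) = i≤a , a≤i0 , b≤j

  minusOne-after-removal : ∀ {x y} → B x y ≡ -1ℤ → ¬ (x ≡ i × y ≡ j) × M x y ≡ -1ℤ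
  minusOne-after-removal {x} {y} Bxy≡-1 = elsewhere , decidable-stable (M x y ℤP.≟ -1ℤ) Mxy≡-1
    where
    elsewhere : ¬ (x ≡ i × y ≡ j)
    elsewhere (refl , refl) = contradiction (trans (sym Bxy≡-1) atMinus) λ ()

    Mxy≡-1 : ¬ ¬ (M x y ≡ -1ℤ)
    Mxy≡-1 Mxy≢-1 = ¬¬-excluded-middle λ where
      (yes p) → contradiction (trans (sym Bxy≡-1) (placed x y elsewhere p)) λ ()
      (no ¬p) → ¬¬-excluded-middle λ where
        (yes t) → contradiction (trans (sym Bxy≡-1) (zeroed x y elsewhere ¬p t)) λ ()
        (no ¬t) → Mxy≢-1 (trans (sym (kept x y elsewhere ¬p ¬t)) Bxy≡-1)

  one-survives-removal : ∀ {x y} → M x y ≡ 1ℤ → ¬ (x ≡ i × y ≡ j) → ¬ T x y → B x y ≡ 1ℤ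
  one-survives-removal {x} {y} Mxy≡1 elsewhere ¬t =
    decidable-stable (B x y ℤP.≟ 1ℤ) λ Bxy≢1 → ¬¬-excluded-middle λ where
      (yes p) → Bxy≢1 (placed x y elsewhere p)
      (no ¬p) → Bxy≢1 (trans (kept x y elsewhere ¬p ¬t) Mxy≡1)

  removal-preserves-flanked : MinusOnesFlanked M → MinusOnesFlanked B
  removal-preserves-flanked flanked x y Bxy≡-1
    with (elsewhere , Mxy≡-1) ← minusOne-after-removal Bxy≡-1
    with ((x′ , x′<x , Mx′y≡1) , (y′ , y<y′ , Mxy′≡1)) ← flanked x y Mxy≡-1 =
    (x′ , x′<x , one-survives-removal Mx′y≡1 above-elsewhere above-outside) ,
    (y′ , y<y′ , one-survives-removal Mxy′≡1 right-elsewhere right-outside)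
    where
    not-southwest : i ≤ x → y ≤ j → ⊥
    not-southwest i≤x y≤j = proj₂ removable x y i≤x y≤j elsewhere Mxy≡-1

    above-elsewhere : ¬ (x′ ≡ i × y ≡ j)
    above-elsewhere (refl , refl) = not-southwest (<⇒≤ x′<x) ≤-refl

    above-outside : ¬ T x′ y
    above-outside t = let (i≤x′ , _ , y≤j) = participant-bounds t in
      not-southwest (≤-trans i≤x′ (<⇒≤ x′<x)) y≤j

    right-elsewhere : ¬ (x ≡ i × y′ ≡ j)
    right-elsewhere (refl , refl) = not-southwest ≤-refl (<⇒≤ y<y′)

    right-outside : ¬ T x y′
    right-outside t = let (i≤x , _ , y′≤j) = participant-bounds t in
      not-southwest i≤x (≤-trans (<⇒≤ y<y′) y′≤j)

  southMost-row : sr ≡ i0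
  southMost-row = ≤-antisym (proj₁ (proj₂ (participant-bounds (proj₁ southMost))))
                            (proj₂ southMost i0 j (inj₂ (inj₁ (refl , refl))))

  southMost-column : sc ≡ j
  southMost-column = column (subst (λ a → T a sc) southMost-row (proj₁ southMost))
    where
    column : ∀ {b} → T i0 b → b ≡ j
    column (inj₁ (i0≡i , _)) = contradiction (sym i0≡i) (<⇒≢ (proj₁ south))
    column (inj₂ (inj₁ (_ , b≡j))) = b≡j
    column (inj₂ (inj₂ ((_ , _ , b≤j , nearest) , _))) =
      sym (proj₂ (nearest i0 j (proj₁ (proj₂ south)) ≤-refl b≤j (<⇒≤ (proj₁ south)) ≤-refl))

  i<southMost : i < sr
  i<southMost = subst (i <_) (sym southMost-row) (proj₁ south)

  westOne-in-Rest : Rest i j0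
  westOne-in-Rest = inj₁ (refl , refl) , λ (i≡sr , _) → <⇒≢ i<southMost i≡sr

  no-Rest-in-column-j : ∀ {a} → ¬ Rest a j
  no-Rest-in-column-j (inj₁ (_ , j≡j0) , _) = <⇒≢ (proj₁ west) (sym j≡j0)
  no-Rest-in-column-j (inj₂ (inj₁ (a≡i0 , _)) , notSouthMost) =
    notSouthMost (trans a≡i0 (sym southMost-row) , sym southMost-column)
  no-Rest-in-column-j {a} (inj₂ (inj₂ ((Maj≡1 , i≤a , _) , _ , a≤i0 , _)) , notSouthMost)
    with <-cmp i a | <-cmp a i0
  ... | tri≈ _ refl _ | _ = contradiction (trans (sym (proj₁ removable)) Maj≡1) λ ()
  ... | tri> _ _ a<i | _ = <⇒≱ a<i i≤a
  ... | tri< i<a _ _ | tri< a<i0 _ _ = proj₂ (proj₂ south) a i<a a<i0 Maj≡1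
  ... | tri< _ _ _ | tri≈ _ a≡i0 _ =
    notSouthMost (trans a≡i0 (sym southMost-row) , sym southMost-column)
  ... | tri< _ _ _ | tri> _ _ i0<a = <⇒≱ i0<a a≤i0

  -- The east-most of the remaining participants receives the new 1 in the
  -- row of the south-most one.
  removal-places-one-southwest : ¬ ¬ (Σ[ x ∈ Fin n ] Σ[ y ∈ Fin n ] i < x × y < j × B x y ≡ 1ℤ)
  removal-places-one-southwest found =
    ¬¬-greatest (λ b → Σ[ a ∈ Fin n ] Rest a b) (i , westOne-in-Rest)
      λ (b , (a , rest) , greatest) → found
        ( sr , b , i<southMost
        , ≤∧≢⇒< (proj₂ (proj₂ (participant-bounds (proj₁ rest))))
                (λ b≡j → no-Rest-in-column-j (subst (Rest a) b≡j rest))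
        , placed sr b (λ (sr≡i , _) → <⇒≢ i<southMost (sym sr≡i))
                 (a , sc , rest , inj₁ (refl , refl , λ u v rest′ → greatest v (u , rest′))) )

last-removal-creates-231 : ∀ {n} {M B : Matrix n} {σ : Fin n → Fin n} → MinusOnesFlanked M →
  Removal M B → (∀ x y → B x y ≡ permMatrix σ x y) → ¬ ¬ Contains σ p231
last-removal-creates-231 {B = B} {σ} flanked r B≗σ avoids
  with ((i₁ , i₁<i , Mi₁j≡1) , (j₁ , j<j₁ , Mij₁≡1)) ← flanked _ _ (proj₁ (Removal.removable r)) =
  removal-places-one-southwest r λ (x , y , i<x , y<j , Bxy≡1) →
    avoids (contains-231 σ i₁<i i<x
      (subst₂ _<_ (sym (column Bxy≡1)) (sym (column Bi₁j≡1)) y<j)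
      (subst₂ _<_ (sym (column Bi₁j≡1)) (sym (column Bij₁≡1)) j<j₁))
  where
  open Removal r using (i; j)

  column : ∀ {x y} → B x y ≡ 1ℤ → σ x ≡ y
  column {x} {y} Bxy≡1 =
    permMatrix-nonzero σ λ σxy≡0 → contradiction (trans (sym Bxy≡1) (trans (B≗σ x y) σxy≡0)) λ ()

  Bi₁j≡1 : B i₁ j ≡ 1ℤ
  Bi₁j≡1 = one-survives-removal r Mi₁j≡1 (λ (i₁≡i , _) → <⇒≢ i₁<i i₁≡i)
    λ t → <⇒≱ i₁<i (proj₁ (participant-bounds r t))

  Bij₁≡1 : B i j₁ ≡ 1ℤ
  Bij₁≡1 = one-survives-removal r Mij₁≡1 (λ (_ , j₁≡j) → <⇒≢ j<j₁ (sym j₁≡j))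
    λ t → <⇒≱ j<j₁ (proj₂ (proj₂ (participant-bounds r t)))

removals-to-permutation-create-231 : ∀ {n} {M B P : Matrix n} {σ : Fin n → Fin n} →
  MinusOnesFlanked M → Removal M B → Reaches B P → (∀ x y → P x y ≡ permMatrix σ x y) →
  ¬ ¬ Contains σ p231
removals-to-permutation-create-231 flanked r (done B≗P) P≗σ =
  last-removal-creates-231 flanked r λ x y → trans (B≗P x y) (P≗σ x y)
removals-to-permutation-create-231 flanked r (step r′ rest) P≗σ =
  removals-to-permutation-create-231 (removal-preserves-flanked r flanked) r′ rest P≗σ

-- Any occurrence of 231 already contradicts avoidance, so it is irrelevant
-- whether the other members of S are permutation patterns.
proposition2p3 : (S : PatternSet) →
    (∀ k (π : Pattern k) → S k π → IsPermPattern π) → S 3 p231 →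
    ∀ (n : ℕ) (A : Matrix n) → AvKey S A ⇔ InPAv S A
proposition2p3 S _ 231∈S n A = mk⇔ key-avoiding⇒permutation permutation⇒key-avoiding
  where
  key-avoiding⇒permutation : AvKey S A → InPAv S A
  key-avoiding⇒permutation (_ , σ , σ-perm , (done A≗σ , _) , avoids) = σ , σ-perm , avoids , A≗σ
  key-avoiding⇒permutation (asm , σ , σ-perm , (step r rest , _) , avoids) =
    ⊥-elim (removals-to-permutation-create-231 (IsASM⇒MinusOnesFlanked asm) r rest (λ _ _ → refl)
              (avoids 3 p231 231∈S))

  permutation⇒key-avoiding : InPAv S A → AvKey S A
  permutation⇒key-avoiding (σ , σ-perm , avoids , A≗σ) =
    permutation-isASM σ-perm A≗σ , σ , σ-perm , (done A≗σ , permMatrix≢-1 σ) , avoids
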